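{- For infinitely many positive integers $n$ with $n \equiv 1 \pmod 4$, and also for infinitely many positive integers $n$ with $n \equiv 3 \pmod 4$, there is an odd cover of the complete graph $K_n$ by $\lceil \frac{n}{2} \rceil$ complete bipartite graphs.
   Context: An odd cover of $K_n$ by complete bipartite graphs is a family $G_1,\dots,G_r$ of complete bipartite graphs, each on some subset of the vertex set of $K_n$ (given by two disjoint colour classes $A,B$, whose edges are all pairs with one end in $A$ and one in $B$), such that every edge of $K_n$ is an edge of an odd number of the $G_i$. -}

module Defs where

open import Data.Nat using (ℕ; zero; suc; _+_; _≤_; _/_)
open import Data.Nat.DivMod using (_%_)
open import Data.Bool using (Bool; true; false; _∧_; _∨_; not; _xor_)
open import Data.Fin using (Fin)
open import Data.Vec using (Vec; foldr)
open import Data.Product using (Σ; ∃; _×_; _,_)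
open import Relation.Binary.PropositionalEquality using (_≡_; _≢_)

-- A complete bipartite graph on a subset of the vertex set Fin n of K_n,
-- given by its two colour classes A, B (as Boolean predicates).
-- Classes are disjoint and nonempty.
record CompleteBipartite (n : ℕ) : Set where
  field
    A : Fin n → Bool
    B : Fin n → Bool
    disjoint : ∀ v → A v ∧ B v ≡ false
    A-nonempty : ∃ λ v → A v ≡ true
    B-nonempty : ∃ λ v → B v ≡ true

open CompleteBipartite public

hasEdge : ∀ {n} → CompleteBipartite n → Fin n → Fin n → Bool
hasEdge G u v = (A G u ∧ B G v) ∨ (B G u ∧ A G v)

edgeParity : ∀ {n r} → Vec (CompleteBipartite n) r → Fin n → Fin n → Bool
edgeParity Gs u v = foldr _ (λ G acc → hasEdge G u v xor acc) false Gs

IsOddCover : ∀ {n r} → Vec (CompleteBipartite n) r → Set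
IsOddCover {n} Gs = ∀ (u v : Fin n) → u ≢ v → edgeParity Gs u v ≡ true

ceilHalf : ℕ → ℕ
ceilHalf n = (n + 1) / 2

HasOddCover : ℕ → ℕ → Set
HasOddCover n r = Σ (Vec (CompleteBipartite n) r) IsOddCover

-- Identify the vertices of K_(3^k) with 𝔽₃^k. Each nonzero linear form ℓ, taken up to sign,
-- gives the biclique ℓ⁻¹(1) versus ℓ⁻¹(2), which contains the edge uv exactly when
-- ℓ(u + v) = 0 ≠ ℓ(u). For distinct nonzero u, v the number of such forms is 3^(k-1) or
-- 3^(k-2), hence odd, while it is 0 when u = 0 or v = 0; so adding the star from 0 gives an
-- odd cover by 1 + (3^k - 1)/2 = ⌈3^k/2⌉ bicliques, and 3^k ≡ 1 or 3 (mod 4) as k is even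
-- or odd. The parity is counted by induction on k: splitting off the first coordinate, the
-- new forms contribute a sum that depends only on the span of the pairs (uᵢ, vᵢ) in 𝔽₃²,
-- a finite state space on which the required identities are checked exhaustively.
module Submission where

open import Defs
open import Data.Nat using (ℕ; _≤_; _%_)
open import Data.Product using (Σ; _×_)
open import Relation.Binary.PropositionalEquality using (_≡_)

open import Data.Bool as Bool using (Bool; true; false; not; _∧_; _∨_; _xor_; if_then_else_)
open import Data.Bool.Properties using (xor-assoc; ∧-inverseʳ)
open import Data.Fin as Fin using (Fin; toℕ; finToFun; funToFin; combine)
open import Data.Fin.Properties using (_≟_; all?; funToFin-finToFin; finToFun-funToFin)
open import Data.List as List using (List; []; _∷_; _++_; length; map)
open import Data.List.Properties using (length-++; length-map)
open import Data.Nat as ℕ using (zero; suc; _^_)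
open import Data.Nat.DivMod using (_mod_; %-distribˡ-*; m%n%n≡m%n; m*n/n≡m)
open import Data.Nat.Properties using (+-identityʳ; ≤-trans; n≤1+n; m≤n*m; *-monoʳ-≤; m^n>0; ^-*-assoc; +-mono-≤; m≤m+n)
open import Data.Nat.Tactic.RingSolver using (solve-∀)
open import Data.Product using (∃; _,_; proj₁; proj₂)
open import Data.Product.Properties as Product using ()
open import Data.Vec using (Vec; []; _∷_; replicate; tabulate; lookup; fromList)
open import Data.Vec.Properties using (lookup∘tabulate; tabulate∘lookup; tabulate-cong) renaming (≡-dec to ≡-decᵥ)
open import Function using (_∘_)
open import Relation.Binary.Definitions using (DecidableEquality)
open import Relation.Binary.PropositionalEquality using (refl; sym; trans; cong; cong₂; subst; _≗_; _≢_; module ≡-Reasoning)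
open import Relation.Nullary using (Dec; does; map′; _×-dec_)
open import Relation.Nullary.Decidable using (from-yes; dec-true; dec-false)

xorSum : ∀ {A : Set} → List A → (A → Bool) → Bool
xorSum xs f = List.foldr (λ x acc → f x xor acc) false xs

xorSum-++ : ∀ {A : Set} (xs ys : List A) f → xorSum (xs ++ ys) f ≡ xorSum xs f xor xorSum ys f
xorSum-++ [] ys f = refl
xorSum-++ (x ∷ xs) ys f = trans (cong (f x xor_) (xorSum-++ xs ys f)) (sym (xor-assoc (f x) _ _))

xorSum-map : ∀ {A B : Set} (g : A → B) (xs : List A) f → xorSum (map g xs) f ≡ xorSum xs (f ∘ g)
xorSum-map g [] f = refl
xorSum-map g (x ∷ xs) f = cong (f (g x) xor_) (xorSum-map g xs f)

xorSum-cong : ∀ {A : Set} (xs : List A) {f g : A → Bool} → (∀ x → f x ≡ g x) → xorSum xs f ≡ xorSum xs g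
xorSum-cong [] e = refl
xorSum-cong (x ∷ xs) e = cong₂ _xor_ (e x) (xorSum-cong xs e)

𝔽₃ : Set
𝔽₃ = Fin 3

pattern 0F = Fin.zero
pattern 1F = Fin.suc Fin.zero
pattern 2F = Fin.suc (Fin.suc Fin.zero)

infixl 6 _+₃_
infixl 7 _*₃_

_+₃_ : 𝔽₃ → 𝔽₃ → 𝔽₃
x +₃ y = (toℕ x ℕ.+ toℕ y) mod 3

_*₃_ : 𝔽₃ → 𝔽₃ → 𝔽₃
x *₃ y = (toℕ x ℕ.* toℕ y) mod 3

+₃-assoc : ∀ x y z → x +₃ (y +₃ z) ≡ (x +₃ y) +₃ z
+₃-assoc = from-yes (all? λ x → all? λ y → all? λ z → x +₃ (y +₃ z) ≟ (x +₃ y) +₃ z)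

is : 𝔽₃ → 𝔽₃ → Bool
is c x = does (x ≟ c)

across : 𝔽₃ → 𝔽₃ → Bool
across x y = (is 1F x ∧ is 2F y) ∨ (is 2F x ∧ is 1F y)

⨁ : (𝔽₃ → Bool) → Bool
⨁ f = f 0F xor (f 1F xor f 2F)

⨁-cong : ∀ {f g : 𝔽₃ → Bool} → (∀ γ → f γ ≡ g γ) → ⨁ f ≡ ⨁ g
⨁-cong e = cong₂ _xor_ (e 0F) (cong₂ _xor_ (e 1F) (e 2F))

infix 7 _∙_

_∙_ : ∀ {k} → Vec 𝔽₃ k → Vec 𝔽₃ k → 𝔽₃
[] ∙ [] = 0F
(x ∷ a) ∙ (y ∷ b) = x *₃ y +₃ a ∙ b

zeros : ∀ k → Vec 𝔽₃ k
zeros k = replicate k 0F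

zeros-∙ : ∀ {k} (q : Vec 𝔽₃ k) → zeros k ∙ q ≡ 0F
zeros-∙ [] = refl
zeros-∙ (_ ∷ q) rewrite zeros-∙ q = refl

_≟ᵥ_ : ∀ {k} → DecidableEquality (Vec 𝔽₃ k)
_≟ᵥ_ = ≡-decᵥ _≟_

isZero : ∀ {k} → Vec 𝔽₃ k → Bool
isZero a = does (a ≟ᵥ zeros _)

vectors : ∀ k → List (Vec 𝔽₃ k)
prefixed : ∀ k → 𝔽₃ → List (Vec 𝔽₃ (suc k))

vectors zero = [] ∷ []
vectors (suc k) = prefixed k 0F ++ prefixed k 1F ++ prefixed k 2F

prefixed k γ = map (γ ∷_) (vectors k)

xorSum-vectors : ∀ k f → xorSum (vectors (suc k)) f ≡ ⨁ λ γ → xorSum (vectors k) (f ∘ (γ ∷_))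
xorSum-vectors k f = begin
  xorSum (prefixed k 0F ++ prefixed k 1F ++ prefixed k 2F) f
    ≡⟨ xorSum-++ (prefixed k 0F) _ f ⟩
  xorSum (prefixed k 0F) f xor xorSum (prefixed k 1F ++ prefixed k 2F) f
    ≡⟨ cong (xorSum (prefixed k 0F) f xor_) (xorSum-++ (prefixed k 1F) _ f) ⟩
  ⨁ (λ γ → xorSum (prefixed k γ) f)
    ≡⟨ ⨁-cong (λ γ → xorSum-map (γ ∷_) (vectors k) f) ⟩
  ⨁ (λ γ → xorSum (vectors k) (f ∘ (γ ∷_))) ∎
  where open ≡-Reasoning

length-vectors : ∀ k → length (vectors k) ≡ 3 ^ k
length-vectors zero = refl
length-vectors (suc k) = begin
  length (prefixed k 0F ++ prefixed k 1F ++ prefixed k 2F)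
    ≡⟨ length-++ (prefixed k 0F) ⟩
  length (prefixed k 0F) ℕ.+ length (prefixed k 1F ++ prefixed k 2F)
    ≡⟨ cong (length (prefixed k 0F) ℕ.+_) (length-++ (prefixed k 1F)) ⟩
  length (prefixed k 0F) ℕ.+ (length (prefixed k 1F) ℕ.+ length (prefixed k 2F))
    ≡⟨ cong₂ ℕ._+_ (length-prefixed 0F) (cong₂ ℕ._+_ (length-prefixed 1F) (length-prefixed 2F)) ⟩
  3 ^ k ℕ.+ (3 ^ k ℕ.+ 3 ^ k)
    ≡⟨ cong (λ n → 3 ^ k ℕ.+ (3 ^ k ℕ.+ n)) (+-identityʳ (3 ^ k)) ⟨
  3 ^ suc k ∎
  where
  open ≡-Reasoning
  length-prefixed : ∀ γ → length (prefixed k γ) ≡ 3 ^ k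
  length-prefixed γ = trans (length-map (γ ∷_) (vectors k)) (length-vectors k)

-- For vectors a, b: whether a = 0, b = 0, a = b. For a subspace W of 𝔽₃²: whether W lies
-- on the line x = 0, y = 0, x = y.
Flags : Set
Flags = Bool × Bool × Bool

noFlag : Flags → Bool
noFlag (p , q , r) = not p ∧ not q ∧ not r

refine : 𝔽₃ → 𝔽₃ → Flags → Flags
refine x y (p , q , r) = is 0F x ∧ p , is 0F y ∧ q , does (x ≟ y) ∧ r

flags : ∀ {k} → Vec 𝔽₃ k → Vec 𝔽₃ k → Flags
flags a b = isZero a , isZero b , does (a ≟ᵥ b)

data Subspace : Set where
  𝟘 ⟨0,1⟩ ⟨1,0⟩ ⟨1,1⟩ ⟨1,2⟩ 𝔽₃² : Subspace

all-subspaces? : ∀ {P : Subspace → Set} → (∀ W → Dec (P W)) → Dec (∀ W → P W)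
all-subspaces? P? =
  map′ (λ (p₀ , p₁ , p₂ , p₃ , p₄ , p₅) → λ { 𝟘 → p₀ ; ⟨0,1⟩ → p₁ ; ⟨1,0⟩ → p₂ ; ⟨1,1⟩ → p₃ ; ⟨1,2⟩ → p₄ ; 𝔽₃² → p₅ })
       (λ p → p 𝟘 , p ⟨0,1⟩ , p ⟨1,0⟩ , p ⟨1,1⟩ , p ⟨1,2⟩ , p 𝔽₃²)
       (P? 𝟘 ×-dec P? ⟨0,1⟩ ×-dec P? ⟨1,0⟩ ×-dec P? ⟨1,1⟩ ×-dec P? ⟨1,2⟩ ×-dec P? 𝔽₃²)

contains : Subspace → 𝔽₃ → 𝔽₃ → Bool
contains 𝟘 s t = is 0F s ∧ is 0F t
contains ⟨0,1⟩ s t = is 0F s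
contains ⟨1,0⟩ s t = is 0F t
contains ⟨1,1⟩ s t = does (s ≟ t)
contains ⟨1,2⟩ s t = is 0F (s +₃ t)
contains 𝔽₃² s t = true

line : 𝔽₃ → 𝔽₃ → Subspace
line 0F 0F = 𝟘
line 0F _ = ⟨0,1⟩
line _ 0F = ⟨1,0⟩
line 1F 1F = ⟨1,1⟩
line 2F 2F = ⟨1,1⟩
line _ _ = ⟨1,2⟩

extend : Subspace → 𝔽₃ → 𝔽₃ → Subspace
extend 𝟘 x y = line x y
extend W x y = if contains W x y then W else 𝔽₃²

span : ∀ {k} → Vec 𝔽₃ k → Vec 𝔽₃ k → Subspace
span [] [] = 𝟘
span (x ∷ a) (y ∷ b) = extend (span a b) x y

subspaceFlags : Subspace → Flags
subspaceFlags 𝟘 = true , true , true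
subspaceFlags ⟨0,1⟩ = true , false , false
subspaceFlags ⟨1,0⟩ = false , true , false
subspaceFlags ⟨1,1⟩ = false , false , true
subspaceFlags ⟨1,2⟩ = false , false , false
subspaceFlags 𝔽₃² = false , false , false

crossingsIn : Subspace → 𝔽₃ → 𝔽₃ → Bool
crossingsIn W α β = ⨁ λ s → ⨁ λ t → contains W s t ∧ across (α +₃ s) (β +₃ t)

_≟ꟳ_ : DecidableEquality Flags
_≟ꟳ_ = Product.≡-dec Bool._≟_ (Product.≡-dec Bool._≟_ Bool._≟_)

subspaceFlags-extend : ∀ W x y → subspaceFlags (extend W x y) ≡ refine x y (subspaceFlags W)
subspaceFlags-extend = from-yes (all-subspaces? λ W → all? λ x → all? λ y →
  subspaceFlags (extend W x y) ≟ꟳ refine x y (subspaceFlags W))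

crossingsIn-extend : ∀ W x y α β →
  crossingsIn (extend W x y) α β ≡ ⨁ λ γ → crossingsIn W (α +₃ x *₃ γ) (β +₃ y *₃ γ)
crossingsIn-extend = from-yes (all-subspaces? λ W → all? λ x → all? λ y → all? λ α → all? λ β →
  crossingsIn (extend W x y) α β Bool.≟ ⨁ λ γ → crossingsIn W (α +₃ x *₃ γ) (β +₃ y *₃ γ))

crossingsIn-flags : ∀ W α β →
  crossingsIn W α β xor noFlag (subspaceFlags W) ≡ noFlag (refine α β (subspaceFlags W))
crossingsIn-flags = from-yes (all-subspaces? λ W → all? λ α → all? λ β →
  crossingsIn W α β xor noFlag (subspaceFlags W) Bool.≟ noFlag (refine α β (subspaceFlags W)))

flags-span : ∀ {k} (a b : Vec 𝔽₃ k) → flags a b ≡ subspaceFlags (span a b)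
flags-span [] [] = refl
flags-span (x ∷ a) (y ∷ b) =
  trans (cong (refine x y) (flags-span a b)) (sym (subspaceFlags-extend (span a b) x y))

-- q ↦ (a ∙ q , b ∙ q) maps 𝔽₃^k onto span a b with fibres of odd size 3^(k - dim), so modulo 2
-- the sum over q is the sum over the span.
xorSum-across-∙ : ∀ {k} (a b : Vec 𝔽₃ k) α β →
  xorSum (vectors k) (λ q → across (α +₃ a ∙ q) (β +₃ b ∙ q)) ≡ crossingsIn (span a b) α β
xorSum-across-∙ [] [] = from-yes (all? λ α → all? λ β →
  across (α +₃ 0F) (β +₃ 0F) xor false Bool.≟ crossingsIn 𝟘 α β)
xorSum-across-∙ {suc k} (x ∷ a) (y ∷ b) α β = begin
  xorSum (vectors (suc k)) (λ q → across (α +₃ (x ∷ a) ∙ q) (β +₃ (y ∷ b) ∙ q))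
    ≡⟨ xorSum-vectors k (λ q → across (α +₃ (x ∷ a) ∙ q) (β +₃ (y ∷ b) ∙ q)) ⟩
  (⨁ λ γ → xorSum (vectors k) (λ q → across (α +₃ (x *₃ γ +₃ a ∙ q)) (β +₃ (y *₃ γ +₃ b ∙ q))))
    ≡⟨ ⨁-cong shift ⟩
  (⨁ λ γ → crossingsIn (span a b) (α +₃ x *₃ γ) (β +₃ y *₃ γ))
    ≡⟨ sym (crossingsIn-extend (span a b) x y α β) ⟩
  crossingsIn (span (x ∷ a) (y ∷ b)) α β ∎
  where
  open ≡-Reasoning
  shift : ∀ γ → xorSum (vectors k) (λ q → across (α +₃ (x *₃ γ +₃ a ∙ q)) (β +₃ (y *₃ γ +₃ b ∙ q)))
              ≡ crossingsIn (span a b) (α +₃ x *₃ γ) (β +₃ y *₃ γ)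
  shift γ = trans (xorSum-cong (vectors k) λ q →
                     cong₂ across (+₃-assoc α (x *₃ γ) (a ∙ q)) (+₃-assoc β (y *₃ γ) (b ∙ q)))
                  (xorSum-across-∙ a b (α +₃ x *₃ γ) (β +₃ y *₃ γ))

record Form (k : ℕ) : Set where
  field
    apply : Vec 𝔽₃ k → 𝔽₃
    attains₁ : ∃ λ v → apply v ≡ 1F
    attains₂ : ∃ λ v → apply v ≡ 2F

open Form

leading : ∀ {k} → Vec 𝔽₃ k → Form (suc k)
leading {k} q = record
  { apply = λ { (α ∷ a) → α +₃ a ∙ q }
  ; attains₁ = 1F ∷ zeros k , cong (1F +₃_) (zeros-∙ q)
  ; attains₂ = 2F ∷ zeros k , cong (2F +₃_) (zeros-∙ q)
  }

lift : ∀ {k} → Form k → Form (suc k)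
lift ℓ = record
  { apply = λ { (_ ∷ a) → apply ℓ a }
  ; attains₁ = 0F ∷ proj₁ (attains₁ ℓ) , proj₂ (attains₁ ℓ)
  ; attains₂ = 0F ∷ proj₁ (attains₂ ℓ) , proj₂ (attains₂ ℓ)
  }

-- The forms whose first nonzero coefficient is 1: one of each pair ℓ, -ℓ of nonzero forms.
forms : ∀ k → List (Form k)
forms zero = []
forms (suc k) = map leading (vectors k) ++ map lift (forms k)

crossings : ∀ {k} → List (Form k) → Vec 𝔽₃ k → Vec 𝔽₃ k → Bool
crossings ℓs a b = xorSum ℓs λ ℓ → across (apply ℓ a) (apply ℓ b)

crossings-forms : ∀ k (a b : Vec 𝔽₃ k) → crossings (forms k) a b ≡ noFlag (flags a b)
crossings-forms zero [] [] = refl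
crossings-forms (suc k) (α ∷ a) (β ∷ b) = begin
  crossings (map leading (vectors k) ++ map lift (forms k)) (α ∷ a) (β ∷ b)
    ≡⟨ xorSum-++ (map leading (vectors k)) (map lift (forms k)) crossesAt ⟩
  crossings (map leading (vectors k)) (α ∷ a) (β ∷ b) xor crossings (map lift (forms k)) (α ∷ a) (β ∷ b)
    ≡⟨ cong₂ _xor_ (xorSum-map leading (vectors k) crossesAt) (xorSum-map lift (forms k) crossesAt) ⟩
  xorSum (vectors k) (λ q → across (α +₃ a ∙ q) (β +₃ b ∙ q)) xor crossings (forms k) a b
    ≡⟨ cong₂ _xor_ (xorSum-across-∙ a b α β) (crossings-forms k a b) ⟩
  crossingsIn (span a b) α β xor noFlag (flags a b)
    ≡⟨ cong (λ f → crossingsIn (span a b) α β xor noFlag f) (flags-span a b) ⟩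
  crossingsIn (span a b) α β xor noFlag (subspaceFlags (span a b))
    ≡⟨ crossingsIn-flags (span a b) α β ⟩
  noFlag (refine α β (subspaceFlags (span a b)))
    ≡⟨ cong (noFlag ∘ refine α β) (flags-span a b) ⟨
  noFlag (flags (α ∷ a) (β ∷ b)) ∎
  where
  open ≡-Reasoning
  crossesAt : Form (suc k) → Bool
  crossesAt ℓ = across (apply ℓ (α ∷ a)) (apply ℓ (β ∷ b))

length-forms : ∀ k → 1 ℕ.+ 2 ℕ.* length (forms k) ≡ 3 ^ k
length-forms zero = refl
length-forms (suc k) = begin
  1 ℕ.+ 2 ℕ.* length (map leading (vectors k) ++ map lift (forms k))
    ≡⟨ cong (λ n → 1 ℕ.+ 2 ℕ.* n) (length-++ (map leading (vectors k))) ⟩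
  1 ℕ.+ 2 ℕ.* (length (map leading (vectors k)) ℕ.+ length (map lift (forms k)))
    ≡⟨ cong₂ (λ m n → 1 ℕ.+ 2 ℕ.* (m ℕ.+ n)) (length-map leading (vectors k)) (length-map lift (forms k)) ⟩
  1 ℕ.+ 2 ℕ.* (length (vectors k) ℕ.+ length (forms k))
    ≡⟨ cong (λ m → 1 ℕ.+ 2 ℕ.* (m ℕ.+ length (forms k))) (length-vectors k) ⟩
  1 ℕ.+ 2 ℕ.* (3 ^ k ℕ.+ length (forms k))
    ≡⟨ regroup (3 ^ k) (length (forms k)) ⟩
  3 ^ k ℕ.+ 3 ^ k ℕ.+ (1 ℕ.+ 2 ℕ.* length (forms k))
    ≡⟨ cong (λ m → 3 ^ k ℕ.+ 3 ^ k ℕ.+ m) (length-forms k) ⟩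
  3 ^ k ℕ.+ 3 ^ k ℕ.+ 3 ^ k
    ≡⟨ triple (3 ^ k) ⟩
  3 ^ suc k ∎
  where
  open ≡-Reasoning
  regroup : ∀ p f → 1 ℕ.+ 2 ℕ.* (p ℕ.+ f) ≡ p ℕ.+ p ℕ.+ (1 ℕ.+ 2 ℕ.* f)
  regroup = solve-∀
  triple : ∀ p → p ℕ.+ p ℕ.+ p ≡ 3 ℕ.* p
  triple = solve-∀

vertex : ∀ k → Fin (3 ^ k) → Vec 𝔽₃ k
vertex k i = tabulate (finToFun i)

index : ∀ {k} → Vec 𝔽₃ k → Fin (3 ^ k)
index v = funToFin (lookup v)

funToFin-cong : ∀ {m n} {f g : Fin m → Fin n} → f ≗ g → funToFin f ≡ funToFin g
funToFin-cong {zero} _ = refl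
funToFin-cong {suc m} f≗g = cong₂ combine (f≗g Fin.zero) (funToFin-cong (f≗g ∘ Fin.suc))

index-vertex : ∀ k (i : Fin (3 ^ k)) → index (vertex k i) ≡ i
index-vertex k i = trans (funToFin-cong (lookup∘tabulate (finToFun {3} {k} i))) (funToFin-finToFin {k} i)

vertex-index : ∀ {k} (v : Vec 𝔽₃ k) → vertex k (index v) ≡ v
vertex-index v = trans (tabulate-cong (finToFun-funToFin (lookup v))) (tabulate∘lookup v)

vertex-injective : ∀ k {i j : Fin (3 ^ k)} → vertex k i ≡ vertex k j → i ≡ j
vertex-injective k {i} {j} e = trans (sym (index-vertex k i)) (trans (cong index e) (index-vertex k j))

attained : ∀ {k} (P : Vec 𝔽₃ k → Bool) → (∃ λ v → P v ≡ true) → ∃ λ u → P (vertex k u) ≡ true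
attained P (v , Pv) = index v , trans (cong P (vertex-index v)) Pv

formBiclique : ∀ {k} → Form k → CompleteBipartite (3 ^ k)
formBiclique {k} ℓ = record
  { A = λ u → is 1F (apply ℓ (vertex k u))
  ; B = λ u → is 2F (apply ℓ (vertex k u))
  ; disjoint = λ u → not-1-and-2 (apply ℓ (vertex k u))
  ; A-nonempty = attained (is 1F ∘ apply ℓ) (proj₁ (attains₁ ℓ) , cong (is 1F) (proj₂ (attains₁ ℓ)))
  ; B-nonempty = attained (is 2F ∘ apply ℓ) (proj₁ (attains₂ ℓ) , cong (is 2F) (proj₂ (attains₂ ℓ)))
  }
  where
  not-1-and-2 : ∀ x → is 1F x ∧ is 2F x ≡ false
  not-1-and-2 = from-yes (all? λ x → is 1F x ∧ is 2F x Bool.≟ false)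

star : ∀ k → CompleteBipartite (3 ^ suc k)
star k = record
  { A = λ u → isZero (vertex (suc k) u)
  ; B = λ u → not (isZero (vertex (suc k) u))
  ; disjoint = λ u → ∧-inverseʳ (isZero (vertex (suc k) u))
  ; A-nonempty = attained isZero (zeros (suc k) , dec-true (zeros (suc k) ≟ᵥ zeros (suc k)) refl)
  ; B-nonempty = attained (not ∘ isZero) (1F ∷ zeros k , refl)
  }

bicliques : ∀ k → List (CompleteBipartite (3 ^ suc k))
bicliques k = star k ∷ map formBiclique (forms (suc k))

edgeParity-fromList : ∀ {n} (Gs : List (CompleteBipartite n)) u v →
  edgeParity (fromList Gs) u v ≡ xorSum Gs (λ G → hasEdge G u v)
edgeParity-fromList [] u v = refl
edgeParity-fromList (G ∷ Gs) u v = cong (hasEdge G u v xor_) (edgeParity-fromList Gs u v)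

star-completes : ∀ {k} (a b : Vec 𝔽₃ k) → a ≢ b →
  ((isZero a ∧ not (isZero b)) ∨ (not (isZero a) ∧ isZero b)) xor noFlag (flags a b) ≡ true
star-completes a b a≢b = parity-table (isZero a) (isZero b) (does (a ≟ᵥ b))
  (dec-false (a ≟ᵥ zeros _ ×-dec b ≟ᵥ zeros _) λ (a≡0 , b≡0) → a≢b (trans a≡0 (sym b≡0)))
  (dec-false (a ≟ᵥ b) a≢b)
  where
  parity-table : ∀ p q r → p ∧ q ≡ false → r ≡ false →
    ((p ∧ not q) ∨ (not p ∧ q)) xor noFlag (p , q , r) ≡ true
  parity-table true true _ () _
  parity-table _ _ true _ ()
  parity-table true false false _ _ = refl
  parity-table false true false _ _ = refl
  parity-table false false false _ _ = refl

bicliques-oddCover : ∀ k → IsOddCover (fromList (bicliques k))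
bicliques-oddCover k u v u≢v = begin
  edgeParity (fromList (bicliques k)) u v
    ≡⟨ edgeParity-fromList (bicliques k) u v ⟩
  hasEdge (star k) u v xor xorSum (map formBiclique (forms (suc k))) (λ G → hasEdge G u v)
    ≡⟨ cong (hasEdge (star k) u v xor_) (xorSum-map formBiclique (forms (suc k)) (λ G → hasEdge G u v)) ⟩
  hasEdge (star k) u v xor crossings (forms (suc k)) (vertex (suc k) u) (vertex (suc k) v)
    ≡⟨ cong (hasEdge (star k) u v xor_) (crossings-forms (suc k) (vertex (suc k) u) (vertex (suc k) v)) ⟩
  hasEdge (star k) u v xor noFlag (flags (vertex (suc k) u) (vertex (suc k) v))
    ≡⟨ star-completes (vertex (suc k) u) (vertex (suc k) v) (u≢v ∘ vertex-injective (suc k)) ⟩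
  true ∎
  where open ≡-Reasoning

length-bicliques : ∀ k → length (bicliques k) ≡ ceilHalf (3 ^ suc k)
length-bicliques k = begin
  suc (length (map formBiclique (forms (suc k))))
    ≡⟨ cong suc (length-map formBiclique (forms (suc k))) ⟩
  suc f
    ≡⟨ m*n/n≡m (suc f) 2 ⟨
  suc f ℕ.* 2 ℕ./ 2
    ≡⟨ cong (ℕ._/ 2) (double f) ⟩
  (1 ℕ.+ 2 ℕ.* f ℕ.+ 1) ℕ./ 2
    ≡⟨ cong (λ n → (n ℕ.+ 1) ℕ./ 2) (length-forms (suc k)) ⟩
  ceilHalf (3 ^ suc k) ∎
  where
  open ≡-Reasoning
  f : ℕ
  f = length (forms (suc k))
  double : ∀ n → suc n ℕ.* 2 ≡ 1 ℕ.+ 2 ℕ.* n ℕ.+ 1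
  double = solve-∀

cover : ∀ k .{{_ : ℕ.NonZero k}} → HasOddCover (3 ^ k) (ceilHalf (3 ^ k))
cover (suc k) =
  subst (HasOddCover (3 ^ suc k)) (length-bicliques k) (fromList (bicliques k) , bicliques-oddCover k)

pow-%≡1 : ∀ {m d} .{{_ : ℕ.NonZero d}} → m % d ≡ 1 → ∀ j → m ^ j % d ≡ 1
pow-%≡1 {m} {d} m%d≡1 zero = trans (cong (_% d) (sym m%d≡1)) (trans (m%n%n≡m%n m d) m%d≡1)
pow-%≡1 {m} {d} m%d≡1 (suc j) =
  trans (%-distribˡ-* m (m ^ j) d)
        (trans (cong₂ (λ x y → (x ℕ.* y) % d) m%d≡1 (pow-%≡1 m%d≡1 j)) (pow-%≡1 m%d≡1 zero))

3^even%4 : ∀ j → 3 ^ (2 ℕ.* j) % 4 ≡ 1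
3^even%4 j = subst (λ n → n % 4 ≡ 1) (^-*-assoc 3 2 j) (pow-%≡1 {9} {4} refl j)

3^odd%4 : ∀ j → 3 ^ suc (2 ℕ.* j) % 4 ≡ 3
3^odd%4 j = trans (%-distribˡ-* 3 (3 ^ (2 ℕ.* j)) 4) (cong (λ r → (3 ℕ.* r) % 4) (3^even%4 j))

n≤3^n : ∀ n → n ≤ 3 ^ n
n≤3^n zero = ℕ.z≤n
n≤3^n (suc n) = +-mono-≤ (m^n>0 3 n) (≤-trans (n≤3^n n) (m≤m+n (3 ^ n) _))

mainTheorem2 : ((m : ℕ) → Σ ℕ (λ n → (m ≤ n) × (1 ≤ n) × (n % 4 ≡ 1) × HasOddCover n (ceilHalf n)))
             × ((m : ℕ) → Σ ℕ (λ n → (m ≤ n) × (1 ≤ n) × (n % 4 ≡ 3) × HasOddCover n (ceilHalf n)))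
mainTheorem2 =
  (λ m → 3 ^ (2 ℕ.* suc m)
       , ≤-trans (≤-trans (m≤n*m m 2) (*-monoʳ-≤ 2 (n≤1+n m))) (n≤3^n (2 ℕ.* suc m))
       , m^n>0 3 (2 ℕ.* suc m) , 3^even%4 (suc m) , cover (2 ℕ.* suc m))
  , (λ m → 3 ^ suc (2 ℕ.* m)
       , ≤-trans (≤-trans (m≤n*m m 2) (n≤1+n _)) (n≤3^n (suc (2 ℕ.* m)))
       , m^n>0 3 (suc (2 ℕ.* m)) , 3^odd%4 m , cover (suc (2 ℕ.* m)))
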